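{- For every closed $\mathrm{BCCSP}_{\|}$ term $p$ there exists a closed BCCSP term $q$ (one with no occurrence of $\|$) such that $\mathcal{E}_{\mathtt{T}}\vdash p\approx q$, where $\mathcal{E}_{\mathtt{T}}=\mathcal{E}_1\cup\{\mathrm{T},\mathrm{TP},\mathrm{EL1}\}$.
   Context: Let $\mathcal{A}$ be a finite non-empty set of actions and $\mathcal{V}$ a countably infinite set of variables. $\mathrm{BCCSP}_{\|}$ terms: $t ::= \mathbf{0} \mid x \mid a.t \mid t+t \mid t \,\|\, t$ ($a\in\mathcal{A}$, $x \in \mathcal{V}$; $ax$ means $a.x$); BCCSP terms are those without $\|$; closed terms contain no variables. $\mathcal{E}\vdash t\approx u$: derivable in equational logic (reflexivity, symmetry, transitivity, substitution instances of axioms, closure under $a.\_$, $+$, $\|$). Axioms with concrete action names stand for all instances with actions from $\mathcal{A}$. $\mathcal{E}_1$: A0 $x+\mathbf{0}\approx x$; A1 $x+y\approx y+x$; A2 $(x+y)+z \approx x+(y+z)$; A3 $x+x\approx x$; P0 $x\|\mathbf{0}\approx x$; P1 $x\|y \approx y \| x$. T: $ax+ay\approx a(x+y)$. TP: $(x+y)\|z\approx x\|z+y\|z$. EL1: $ax\|by\approx a(x\|by)+b(ax\|y)$. -}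

module Defs where

open import Data.Nat using (ℕ; suc)
open import Data.Fin using (Fin)

-- Actions: a finite non-empty set, represented as Fin (suc n) for a parameter n.
-- Variables: the countably infinite set ℕ.

module Terms (n : ℕ) where

  Act : Set
  Act = Fin (suc n)

  Var : Set
  Var = ℕ

  data Term : Set where
    𝟎    : Term
    var  : Var → Term
    _·_  : Act → Term → Term
    _⊕_  : Term → Term → Term
    _∥_  : Term → Term → Term

  infixr 7 _·_
  infixl 5 _⊕_
  infixl 6 _∥_

  data Closed : Term → Set where
    𝟎c : Closed 𝟎
    ·c : ∀ {a t} → Closed t → Closed (a · t)
    ⊕c : ∀ {t u} → Closed t → Closed u → Closed (t ⊕ u)
    ∥c : ∀ {t u} → Closed t → Closed u → Closed (t ∥ u)

  data BCCSP : Term → Set where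
    𝟎b : BCCSP 𝟎
    vb : ∀ {x} → BCCSP (var x)
    ·b : ∀ {a t} → BCCSP t → BCCSP (a · t)
    ⊕b : ∀ {t u} → BCCSP t → BCCSP u → BCCSP (t ⊕ u)

  Subst : Set
  Subst = Var → Term

  _[_] : Term → Subst → Term
  𝟎 [ σ ] = 𝟎
  var x [ σ ] = σ x
  (a · t) [ σ ] = a · (t [ σ ])
  (t ⊕ u) [ σ ] = (t [ σ ]) ⊕ (u [ σ ])
  (t ∥ u) [ σ ] = (t [ σ ]) ∥ (u [ σ ])

  x y z : Term
  x = var 0
  y = var 1
  z = var 2

  data E-T : Term → Term → Set where
    A0  : E-T (x ⊕ 𝟎) x
    A1  : E-T (x ⊕ y) (y ⊕ x)
    A2  : E-T ((x ⊕ y) ⊕ z) (x ⊕ (y ⊕ z))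
    A3  : E-T (x ⊕ x) x
    P0  : E-T (x ∥ 𝟎) x
    P1  : E-T (x ∥ y) (y ∥ x)
    T   : ∀ (a : Act) → E-T ((a · x) ⊕ (a · y)) (a · (x ⊕ y))
    TP  : E-T ((x ⊕ y) ∥ z) ((x ∥ z) ⊕ (y ∥ z))
    EL1 : ∀ (a b : Act) →
          E-T ((a · x) ∥ (b · y)) ((a · (x ∥ (b · y))) ⊕ (b · ((a · x) ∥ y)))

  data _⊢_≈_ (E : Term → Term → Set) : Term → Term → Set where
    refl  : ∀ {t} → E ⊢ t ≈ t
    sym   : ∀ {t u} → E ⊢ t ≈ u → E ⊢ u ≈ t
    trans : ∀ {t u v} → E ⊢ t ≈ u → E ⊢ u ≈ v → E ⊢ t ≈ v
    ax    : ∀ {t u} (σ : Subst) → E t u → E ⊢ (t [ σ ]) ≈ (u [ σ ])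
    cong· : ∀ {t u} (a : Act) → E ⊢ t ≈ u → E ⊢ (a · t) ≈ (a · u)
    cong⊕ : ∀ {t t' u u'} → E ⊢ t ≈ t' → E ⊢ u ≈ u' → E ⊢ (t ⊕ u) ≈ (t' ⊕ u')
    cong∥ : ∀ {t t' u u'} → E ⊢ t ≈ t' → E ⊢ u ≈ u' → E ⊢ (t ∥ u) ≈ (t' ∥ u')

{-# OPTIONS --safe #-}
module Submission where

open import Defs
open import Data.Nat using (ℕ; suc)
open import Data.Product using (Σ; _×_; _,_)

-- Parallel composition is eliminated bottom-up: closed BCCSP terms are built
-- from 𝟎, prefixes and sums, and the parallel composition of two of them is
-- again rewritten into one by distributing over sums (TP, P1), dropping 𝟎 (P0)
-- and interleaving two prefixes (EL1), which recurses on strictly smaller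
-- arguments.

module _ (n : ℕ) where
  open Terms n

  data Proc : Set where
    nil : Proc
    _∙_ : Act → Proc → Proc
    _+_ : Proc → Proc → Proc

  ⌜_⌝ : Proc → Term
  ⌜ nil ⌝   = 𝟎
  ⌜ a ∙ p ⌝ = a · ⌜ p ⌝
  ⌜ p + q ⌝ = ⌜ p ⌝ ⊕ ⌜ q ⌝

  ⌜⌝-closed : ∀ p → Closed ⌜ p ⌝
  ⌜⌝-closed nil     = 𝟎c
  ⌜⌝-closed (a ∙ p) = ·c (⌜⌝-closed p)
  ⌜⌝-closed (p + q) = ⊕c (⌜⌝-closed p) (⌜⌝-closed q)

  ⌜⌝-bccsp : ∀ p → BCCSP ⌜ p ⌝
  ⌜⌝-bccsp nil     = 𝟎b
  ⌜⌝-bccsp (a ∙ p) = ·b (⌜⌝-bccsp p)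
  ⌜⌝-bccsp (p + q) = ⊕b (⌜⌝-bccsp p) (⌜⌝-bccsp q)

  _≃_ : Term → Term → Set
  t ≃ u = E-T ⊢ t ≈ u

  ⟨_,_,_⟩ : Term → Term → Term → Subst
  ⟨ t , u , v ⟩ 0 = t
  ⟨ t , u , v ⟩ 1 = u
  ⟨ t , u , v ⟩ 2 = v
  ⟨ t , u , v ⟩ (suc (suc (suc _))) = 𝟎

  ∥-identityʳ : ∀ t → (t ∥ 𝟎) ≃ t
  ∥-identityʳ t = ax ⟨ t , 𝟎 , 𝟎 ⟩ P0

  ∥-comm : ∀ t u → (t ∥ u) ≃ (u ∥ t)
  ∥-comm t u = ax ⟨ t , u , 𝟎 ⟩ P1

  ∥-identityˡ : ∀ t → (𝟎 ∥ t) ≃ t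
  ∥-identityˡ t = trans (∥-comm 𝟎 t) (∥-identityʳ t)

  ∥-distribʳ-⊕ : ∀ t u v → ((t ⊕ u) ∥ v) ≃ ((t ∥ v) ⊕ (u ∥ v))
  ∥-distribʳ-⊕ t u v = ax ⟨ t , u , v ⟩ TP

  ∥-distribˡ-⊕ : ∀ t u v → (t ∥ (u ⊕ v)) ≃ ((t ∥ u) ⊕ (t ∥ v))
  ∥-distribˡ-⊕ t u v =
    trans (∥-comm t (u ⊕ v))
      (trans (∥-distribʳ-⊕ u v t) (cong⊕ (∥-comm u t) (∥-comm v t)))

  expansion : ∀ a b t u → ((a · t) ∥ (b · u)) ≃ ((a · (t ∥ (b · u))) ⊕ (b · ((a · t) ∥ u)))
  expansion a b t u = ax ⟨ t , u , 𝟎 ⟩ (EL1 a b)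

  _∥ₚ_ : Proc → Proc → Proc
  nil       ∥ₚ q         = q
  (p₁ + p₂) ∥ₚ q         = (p₁ ∥ₚ q) + (p₂ ∥ₚ q)
  (a ∙ p)   ∥ₚ nil       = a ∙ p
  (a ∙ p)   ∥ₚ (q₁ + q₂) = ((a ∙ p) ∥ₚ q₁) + ((a ∙ p) ∥ₚ q₂)
  (a ∙ p)   ∥ₚ (b ∙ q)   = (a ∙ (p ∥ₚ (b ∙ q))) + (b ∙ ((a ∙ p) ∥ₚ q))

  ∥ₚ-sound : ∀ p q → (⌜ p ⌝ ∥ ⌜ q ⌝) ≃ ⌜ p ∥ₚ q ⌝
  ∥ₚ-sound nil       q = ∥-identityˡ ⌜ q ⌝
  ∥ₚ-sound (p₁ + p₂) q =
    trans (∥-distribʳ-⊕ ⌜ p₁ ⌝ ⌜ p₂ ⌝ ⌜ q ⌝) (cong⊕ (∥ₚ-sound p₁ q) (∥ₚ-sound p₂ q))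
  ∥ₚ-sound (a ∙ p)   nil = ∥-identityʳ (a · ⌜ p ⌝)
  ∥ₚ-sound (a ∙ p) (q₁ + q₂) =
    trans (∥-distribˡ-⊕ (a · ⌜ p ⌝) ⌜ q₁ ⌝ ⌜ q₂ ⌝)
      (cong⊕ (∥ₚ-sound (a ∙ p) q₁) (∥ₚ-sound (a ∙ p) q₂))
  ∥ₚ-sound (a ∙ p) (b ∙ q) =
    trans (expansion a b ⌜ p ⌝ ⌜ q ⌝)
      (cong⊕ (cong· a (∥ₚ-sound p (b ∙ q))) (cong· b (∥ₚ-sound (a ∙ p) q)))

  eliminate-∥ : ∀ t → Closed t → Σ Proc (λ p → t ≃ ⌜ p ⌝)
  eliminate-∥ 𝟎 𝟎c = nil , refl
  eliminate-∥ (a · t) (·c ct) with eliminate-∥ t ct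
  ... | p , t≃p = a ∙ p , cong· a t≃p
  eliminate-∥ (t ⊕ u) (⊕c ct cu) with eliminate-∥ t ct | eliminate-∥ u cu
  ... | p , t≃p | q , u≃q = p + q , cong⊕ t≃p u≃q
  eliminate-∥ (t ∥ u) (∥c ct cu) with eliminate-∥ t ct | eliminate-∥ u cu
  ... | p , t≃p | q , u≃q = p ∥ₚ q , trans (cong∥ t≃p u≃q) (∥ₚ-sound p q)

proposition5p13 : (n : ℕ) → let open Terms n in
    (p : Term) → Closed p →
    Σ Term (λ q → Closed q × BCCSP q × (E-T ⊢ p ≈ q))
proposition5p13 n p closed with eliminate-∥ n p closed
... | q , p≃q = ⌜_⌝ n q , ⌜⌝-closed n q , ⌜⌝-bccsp n q , p≃q
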